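{- Let $\mathcal D$ be an abstract system of proof notations, let $s\ge 2$ and $h\ge 2$ be natural numbers, and let $d\in\mathcal D$ be $s$-bounded (in $\mathcal D$) with height $\|d\|=h$. Then for every $k\ge 1$ the element $\mathsf E^k d\in\mathrm{Ecl}(\mathcal D)$ is $2_{k-1}(2\cdot h)\cdot s$-bounded (in $\mathrm{Ecl}(\mathcal D)$).
   Context: An abstract system of proof notations is a set $\mathcal D$ together with two functions $|\cdot|,\|\cdot\|\colon\mathcal D\to\mathbb N\setminus\{0\}$ ("size" and "height") and a relation $\to\,\subseteq\mathcal D\times\mathcal D$ ("reduction to a sub-derivation") such that $d\to d'$ implies $\|d'\|<\|d\|$. Let $\to^\ast$ be the reflexive transitive closure of $\to$. For $d\in\mathcal D$, $\mathcal D\restriction d=\{d'\mid d\to^\ast d'\}$, with the structure induced by $\mathcal D$. A system $\mathcal D$ is $s$-bounded if $|d|\le s$ for all $d\in\mathcal D$; an element $d$ of a system $\mathcal D$ is $s$-bounded if $\mathcal D\restriction d$ is $s$-bounded. The cut elimination closure $\mathrm{Ecl}(\mathcal D)$ is the abstract system extending $\mathcal D$ defined inductively, with new symbols $\mathsf I,\mathsf R,\mathsf E$: every $d\in\mathcal D$ is in $\mathrm{Ecl}(\mathcal D)$ (with its size and height); if $d,e\in\mathrm{Ecl}(\mathcal D)$ then $\mathsf I d,\ \mathsf R de,\ \mathsf E d\in\mathrm{Ecl}(\mathcal D)$, with $|\mathsf I d|=|d|+1$, $|\mathsf R de|=|d|+|e|+1$, $|\mathsf E d|=|d|+1$, and $\|\mathsf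 I d\|=\|d\|$, $\|\mathsf R de\|=\|d\|+\|e\|$, $\|\mathsf E d\|=2^{\|d\|}-1$. The relation $\to$ on $\mathrm{Ecl}(\mathcal D)$ is inductively generated by: $d\to d'$ whenever this holds in $\mathcal D$; if $d\to d'$ then $\mathsf I d\to\mathsf I d'$ and $\mathsf E d\to\mathsf E d'$; if $e\to e'$ then $\mathsf R de\to\mathsf R de'$; $\mathsf R de\to\mathsf I d$ always; if $d\to d'$ and $d\to d''$ then $\mathsf E d\to\mathsf R(\mathsf E d')(\mathsf E d'')$. We write $\mathsf E^k d$ for $\mathsf E$ applied $k$ times to $d$. Iterated exponentiation: $2_0(x)=x$, $2_{n+1}(x)=2^{2_n(x)}$. -}

module Defs where

open import Level using (Level; suc; _⊔_)
open import Data.Nat using (ℕ; zero; suc; _+_; _*_; _∸_; _^_; _≤_; _<_)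
open import Relation.Binary.Construct.Closure.ReflexiveTransitive using (Star)

record ProofSystem (a ℓ : Level) : Set (Level.suc (a ⊔ ℓ)) where
  field
    Carrier    : Set a
    size       : Carrier → ℕ
    height     : Carrier → ℕ
    _⟶_        : Carrier → Carrier → Set ℓ
    size-pos   : ∀ d → 1 ≤ size d
    height-pos : ∀ d → 1 ≤ height d
    ⟶-height   : ∀ {d d'} → d ⟶ d' → height d' < height d

module _ {a ℓ : Level} (𝒟 : ProofSystem a ℓ) where
  open ProofSystem 𝒟

  _⟶*_ : Carrier → Carrier → Set (a ⊔ ℓ)
  _⟶*_ = Star _⟶_

  Bounded : ℕ → Carrier → Set (a ⊔ ℓ)
  Bounded s d = ∀ d' → d ⟶* d' → size d' ≤ s

tower : ℕ → ℕ → ℕ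
tower zero x = x
tower (suc n) x = 2 ^ tower n x

module EclConstruction {a ℓ : Level} (𝒟 : ProofSystem a ℓ) where
  private module D = ProofSystem 𝒟

  data Ecl : Set a where
    ι : D.Carrier → Ecl
    I : Ecl → Ecl
    R : Ecl → Ecl → Ecl
    E : Ecl → Ecl

  size : Ecl → ℕ
  size (ι d)   = D.size d
  size (I d)   = size d + 1
  size (R d e) = size d + size e + 1
  size (E d)   = size d + 1

  height : Ecl → ℕ
  height (ι d)   = D.height d
  height (I d)   = height d
  height (R d e) = height d + height e
  height (E d)   = 2 ^ height d ∸ 1

  data _⟶_ : Ecl → Ecl → Set (a ⊔ ℓ) where
    base : ∀ {d d'} → d D.⟶ d' → ι d ⟶ ι d'
    I-cong : ∀ {d d'} → d ⟶ d' → I d ⟶ I d'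
    E-cong : ∀ {d d'} → d ⟶ d' → E d ⟶ E d'
    R-cong : ∀ {d e e'} → e ⟶ e' → R d e ⟶ R d e'
    R-I : ∀ {d e} → R d e ⟶ I d
    E-R : ∀ {d d' d''} → d ⟶ d' → d ⟶ d'' → E d ⟶ R (E d') (E d'')

  Eⁿ : ℕ → Ecl → Ecl
  Eⁿ zero d = d
  Eⁿ (suc k) d = E (Eⁿ k d)

  EclBounded : ℕ → Ecl → Set (a ⊔ ℓ)
  EclBounded s d = ∀ d' → Star _⟶_ d d' → size d' ≤ s

module Submission where

-- Call an element u of Ecl(𝒟) leaf-bounded if every 𝒟-element
-- occurring in u is s-bounded.  To such u we assign a number
-- sizeBound u, defined by recursion on u, which (i) dominates size u,
-- (ii) does not increase along a reduction step, while (iii) reduction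
-- preserves leaf-boundedness.  Hence every u is (sizeBound u)-bounded.
-- The E-clause  sizeBound (E u) = ‖u‖ · (sizeBound u + 2)  is chosen so
-- that the step  E u ⟶ R (E u') (E u'')  respects (ii): it only uses
-- ‖u'‖, ‖u''‖ < ‖u‖, which is why heights of Ecl(𝒟) must decrease
-- under reduction (shown first).

open import Defs
open import Level using (Level)
open import Data.Nat using (ℕ; _+_; _*_; _∸_; _≤_)
open import Relation.Binary.PropositionalEquality using (_≡_)

open import Data.Nat using (zero; suc; _<_; _^_; _⊔_; z≤n; s≤s; _≤′_; ≤′-refl; ≤′-step)
open import Data.Nat.Properties
open import Data.Nat.Tactic.RingSolver using (solve-∀)
open import Data.Product using (_×_; _,_)
open import Relation.Binary.PropositionalEquality using (sym; cong; cong₂)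
open import Relation.Binary.Construct.Closure.ReflexiveTransitive using (ε; _◅_)

mersenne : ℕ → ℕ
mersenne n = 2 ^ n ∸ 1

suc-mersenne : ∀ n → suc (mersenne n) ≡ 2 ^ n
suc-mersenne n = m+[n∸m]≡n (m^n>0 2 n)

mersenne-pos : ∀ {n} → 1 ≤ n → 1 ≤ mersenne n
mersenne-pos n≥1 = ∸-monoˡ-≤ 1 (^-monoʳ-≤ 2 n≥1)

mersenne-mono-< : ∀ {m n} → m < n → mersenne m < mersenne n
mersenne-mono-< {m} m<n = ∸-monoˡ-< (^-monoʳ-< 2 (s≤s (s≤s z≤n)) m<n) (m^n>0 2 m)

pow-sum≤ : ∀ {a b c} → a < c → b < c → 2 ^ a + 2 ^ b ≤ 2 ^ c
pow-sum≤ {c = suc c} (s≤s a≤c) (s≤s b≤c) =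
  ≤-trans (+-mono-≤ (^-monoʳ-≤ 2 a≤c) (^-monoʳ-≤ 2 b≤c))
          (≤-reflexive (cong (2 ^ c +_) (sym (+-identityʳ (2 ^ c)))))

mersenne-sum< : ∀ {a b c} → a < c → b < c → mersenne a + mersenne b < mersenne c
mersenne-sum< {a} {b} {c} a<c b<c = ≤-pred (begin
  suc (suc (mersenne a + mersenne b)) ≡⟨ cong suc (sym (+-suc (mersenne a) (mersenne b))) ⟩
  suc (mersenne a) + suc (mersenne b) ≡⟨ cong₂ _+_ (suc-mersenne a) (suc-mersenne b) ⟩
  2 ^ a + 2 ^ b                       ≤⟨ pow-sum≤ a<c b<c ⟩
  2 ^ c                               ≡⟨ sym (suc-mersenne c) ⟩
  suc (mersenne c)                    ∎)
  where open ≤-Reasoning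

n<2^n : ∀ n → n < 2 ^ n
n<2^n zero    = s≤s z≤n
n<2^n (suc n) = +-mono-≤ (m^n>0 2 n) (≤-trans (n<2^n n) (m≤m+n (2 ^ n) 0))

double≤2^ : ∀ n → 2 * n ≤ 2 ^ n
double≤2^ zero    = z≤n
double≤2^ (suc n) = *-monoʳ-≤ 2 (n<2^n n)

double-mersenne≤ : ∀ {y} → 1 ≤ y → 2 * mersenne y ≤ 2 ^ (2 * y)
double-mersenne≤ {y} y≥1 =
  ≤-trans (*-monoʳ-≤ 2 (m∸n≤m (2 ^ y) 1))
          (^-monoʳ-≤ 2 {suc y} (≤-trans (≤-reflexive (+-comm 1 y))
                                         (+-monoʳ-≤ y (≤-trans y≥1 (m≤m+n y 0)))))

mersenne-mul≤ : ∀ {y x} → 2 * y ≤′ x → mersenne y * (x + 1) ≤ 2 ^ x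
mersenne-mul≤ {y} ≤′-refl = ≤-pred (begin
  suc (q * (2 * y + 1)) ≤⟨ s≤s (*-monoʳ-≤ q (+-monoˡ-≤ 1 (double≤2^ y))) ⟩
  suc (q * (2 ^ y + 1)) ≡⟨ cong (λ p → suc (q * (p + 1))) (sym (suc-mersenne y)) ⟩
  suc (q * (suc q + 1)) ≡⟨ square q ⟩
  suc q * suc q         ≡⟨ cong₂ _*_ (suc-mersenne y) (suc-mersenne y) ⟩
  2 ^ y * 2 ^ y         ≡⟨ sym (^-distribˡ-+-* 2 y y) ⟩
  2 ^ (y + y)           ≡⟨ cong (λ z → 2 ^ (y + z)) (sym (+-identityʳ y)) ⟩
  2 ^ (2 * y)           ≤⟨ n≤1+n _ ⟩
  suc (2 ^ (2 * y))     ∎)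
  where
  open ≤-Reasoning
  q = mersenne y
  square : ∀ q → suc (q * (suc q + 1)) ≡ suc q * suc q
  square = solve-∀
mersenne-mul≤ {y} (≤′-step {x} 2y≤x) = begin
  mersenne y * suc (x + 1)      ≡⟨ *-suc (mersenne y) (x + 1) ⟩
  mersenne y + mersenne y * (x + 1)
    ≤⟨ +-mono-≤ (≤-trans (m∸n≤m (2 ^ y) 1) (^-monoʳ-≤ 2 y≤x)) (mersenne-mul≤ {y} 2y≤x) ⟩
  2 ^ x + 2 ^ x                 ≡⟨ cong (2 ^ x +_) (sym (+-identityʳ (2 ^ x))) ⟩
  2 ^ suc x                     ∎
  where
  open ≤-Reasoning
  y≤x : y ≤ x
  y≤x = ≤-trans (m≤m+n y (y + 0)) (≤′⇒≤ 2y≤x)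

E-budget : ∀ {H h' b b' x} → h' < H → b' ≤ b → x ≤ b + 1 →
           x + h' * (b' + 2) + 1 ≤ H * (b + 2)
E-budget {suc m} {h'} {b} {b'} {x} (s≤s h'≤m) b'≤b x≤b+1 = begin
  x + h' * (b' + 2) + 1     ≤⟨ +-monoˡ-≤ 1 (+-mono-≤ x≤b+1 (*-mono-≤ h'≤m (+-monoˡ-≤ 2 b'≤b))) ⟩
  b + 1 + m * (b + 2) + 1   ≡⟨ regroup b (m * (b + 2)) ⟩
  b + 2 + m * (b + 2)       ∎
  where
  open ≤-Reasoning
  regroup : ∀ b z → b + 1 + z + 1 ≡ b + 2 + z
  regroup = solve-∀

module Heights {a ℓ : Level} (𝒟 : ProofSystem a ℓ) where
  private module D = ProofSystem 𝒟
  open EclConstruction 𝒟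

  height-pos : ∀ u → 1 ≤ height u
  height-pos (ι d)   = D.height-pos d
  height-pos (I u)   = height-pos u
  height-pos (R u v) = ≤-trans (height-pos u) (m≤m+n (height u) (height v))
  height-pos (E u)   = mersenne-pos (height-pos u)

  ⟶-height : ∀ {u u'} → u ⟶ u' → height u' < height u
  ⟶-height (base p)             = D.⟶-height p
  ⟶-height (I-cong p)           = ⟶-height p
  ⟶-height (E-cong p)           = mersenne-mono-< (⟶-height p)
  ⟶-height (R-cong {d} p)       = +-monoʳ-< (height d) (⟶-height p)
  ⟶-height (R-I {d} {e})        =
    ≤-trans (≤-reflexive (+-comm 1 (height d))) (+-monoʳ-≤ (height d) (height-pos e))
  ⟶-height (E-R p q)            = mersenne-sum< (⟶-height p) (⟶-height q)

module Invariant {a ℓ : Level} (𝒟 : ProofSystem a ℓ) (s : ℕ) where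
  open EclConstruction 𝒟
  open Heights 𝒟

  LeavesBounded : Ecl → Set (a Level.⊔ ℓ)
  LeavesBounded (ι d)   = Bounded 𝒟 s d
  LeavesBounded (I u)   = LeavesBounded u
  LeavesBounded (R u v) = LeavesBounded u × LeavesBounded v
  LeavesBounded (E u)   = LeavesBounded u

  -- A bound on the size of everything u reduces to.
  sizeBound : Ecl → ℕ
  sizeBound (ι d)   = s
  sizeBound (I u)   = sizeBound u + 1
  sizeBound (R u v) = (sizeBound u + 1) ⊔ (size u + sizeBound v + 1)
  sizeBound (E u)   = height u * (sizeBound u + 2)

  size≤sizeBound : ∀ u → LeavesBounded u → size u ≤ sizeBound u
  size≤sizeBound (ι d)   bd         = bd d ε
  size≤sizeBound (I u)   bu         = +-monoˡ-≤ 1 (size≤sizeBound u bu)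
  size≤sizeBound (R u v) (bu , bv)  =
    ≤-trans (+-monoˡ-≤ 1 (+-monoʳ-≤ (size u) (size≤sizeBound v bv)))
            (m≤n⊔m (sizeBound u + 1) _)
  size≤sizeBound (E u)   bu         =
    ≤-trans (≤-reflexive (cong (_+ 1) (sym (+-identityʳ (size u)))))
            (E-budget {b' = sizeBound u} (height-pos u) ≤-refl
                      (≤-trans (size≤sizeBound u bu) (m≤m+n (sizeBound u) 1)))

  -- Reducts only contain reducts of leaves, which are again s-bounded.
  ⟶-LeavesBounded : ∀ {u u'} → u ⟶ u' → LeavesBounded u → LeavesBounded u'
  ⟶-LeavesBounded (base p)   bd        = λ d' r → bd d' (p ◅ r)
  ⟶-LeavesBounded (I-cong p) bu        = ⟶-LeavesBounded p bu
  ⟶-LeavesBounded (E-cong p) bu        = ⟶-LeavesBounded p bu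
  ⟶-LeavesBounded (R-cong p) (bu , bv) = bu , ⟶-LeavesBounded p bv
  ⟶-LeavesBounded R-I        (bu , _)  = bu
  ⟶-LeavesBounded (E-R p q)  bu        = ⟶-LeavesBounded p bu , ⟶-LeavesBounded q bu

  -- sizeBound never increases; the E-R case is where the E-clause of
  -- sizeBound and the decrease of heights are needed.
  ⟶-sizeBound : ∀ {u u'} → u ⟶ u' → LeavesBounded u → sizeBound u' ≤ sizeBound u
  ⟶-sizeBound (base p)       _         = ≤-refl
  ⟶-sizeBound (I-cong p)     bu        = +-monoˡ-≤ 1 (⟶-sizeBound p bu)
  ⟶-sizeBound (E-cong p)     bu        =
    *-mono-≤ (<⇒≤ (⟶-height p)) (+-monoˡ-≤ 2 (⟶-sizeBound p bu))
  ⟶-sizeBound (R-cong {d} p) (_ , bv)  =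
    ⊔-monoʳ-≤ (sizeBound d + 1) (+-monoˡ-≤ 1 (+-monoʳ-≤ (size d) (⟶-sizeBound p bv)))
  ⟶-sizeBound (R-I {d})      _         = m≤m⊔n (sizeBound d + 1) _
  ⟶-sizeBound (E-R {d' = d'} p q) bu  = ⊔-lub
    (E-budget (⟶-height p) (⟶-sizeBound p bu) z≤n)
    (E-budget (⟶-height q) (⟶-sizeBound q bu)
      (+-monoˡ-≤ 1 (≤-trans (size≤sizeBound d' (⟶-LeavesBounded p bu)) (⟶-sizeBound p bu))))

  sizeBound-bounds : ∀ u → LeavesBounded u → EclBounded (sizeBound u) u
  sizeBound-bounds u bu .u ε            = size≤sizeBound u bu
  sizeBound-bounds u bu u'  (step ◅ r) =
    ≤-trans (sizeBound-bounds _ (⟶-LeavesBounded step bu) u' r) (⟶-sizeBound step bu)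

  -- The only leaf of Eᵏ d is d itself.
  Eⁿ-LeavesBounded : ∀ k {d} → Bounded 𝒟 s d → LeavesBounded (Eⁿ k (ι d))
  Eⁿ-LeavesBounded zero    bd = bd
  Eⁿ-LeavesBounded (suc k) bd = Eⁿ-LeavesBounded k bd

module Tower {a ℓ : Level} (𝒟 : ProofSystem a ℓ) (s : ℕ) (2≤s : 2 ≤ s) where
  open EclConstruction 𝒟
  open Heights 𝒟
  open Invariant 𝒟 s

  E-height : ∀ {u x} → 2 * height u ≤ x → 2 * height (E u) ≤ 2 ^ x
  E-height {u} 2h≤x = ≤-trans (double-mersenne≤ (height-pos u)) (^-monoʳ-≤ 2 2h≤x)

  E-sizeBound : ∀ {u x} → 2 * height u ≤ x → sizeBound (E u) ≤ x * s →
                sizeBound (E (E u)) ≤ 2 ^ x * s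
  E-sizeBound {u} {x} 2h≤x bound = begin
    mersenne (height u) * (sizeBound (E u) + 2)
      ≤⟨ *-monoʳ-≤ (mersenne (height u)) (+-mono-≤ bound 2≤s) ⟩
    mersenne (height u) * (x * s + s)       ≡⟨ factor (mersenne (height u)) x s ⟩
    mersenne (height u) * (x + 1) * s       ≤⟨ *-monoˡ-≤ s (mersenne-mul≤ {height u} (≤⇒≤′ 2h≤x)) ⟩
    2 ^ x * s                               ∎
    where
    open ≤-Reasoning
    factor : ∀ m x s → m * (x * s + s) ≡ m * (x + 1) * s
    factor = solve-∀

  module _ {h : ℕ} {d : ProofSystem.Carrier 𝒟} (‖d‖≡h : ProofSystem.height 𝒟 d ≡ h) where

    Eⁿ-height : ∀ k → 2 * height (Eⁿ k (ι d)) ≤ tower k (2 * h)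
    Eⁿ-height zero    = ≤-reflexive (cong (2 *_) ‖d‖≡h)
    Eⁿ-height (suc k) = E-height {Eⁿ k (ι d)} (Eⁿ-height k)

    Eⁿ-sizeBound : ∀ k → sizeBound (Eⁿ (suc k) (ι d)) ≤ tower k (2 * h) * s
    Eⁿ-sizeBound zero    = begin
      ProofSystem.height 𝒟 d * (s + 2) ≤⟨ *-monoʳ-≤ (ProofSystem.height 𝒟 d) (+-monoʳ-≤ s 2≤s) ⟩
      ProofSystem.height 𝒟 d * (s + s) ≡⟨ cong (λ z → z * (s + s)) ‖d‖≡h ⟩
      h * (s + s)                      ≡⟨ double h s ⟩
      2 * h * s                        ∎
      where
      open ≤-Reasoning
      double : ∀ h s → h * (s + s) ≡ 2 * h * s
      double = solve-∀
    Eⁿ-sizeBound (suc k) = E-sizeBound {Eⁿ k (ι d)} (Eⁿ-height k) (Eⁿ-sizeBound k)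

mainTheorem1 : ∀ {a ℓ : Level} (𝒟 : ProofSystem a ℓ) (s h : ℕ) (d : ProofSystem.Carrier 𝒟) → 2 ≤ s → 2 ≤ h → Bounded 𝒟 s d → ProofSystem.height 𝒟 d ≡ h → ∀ (k : ℕ) → 1 ≤ k → EclConstruction.EclBounded 𝒟 (tower (k ∸ 1) (2 * h) * s) (EclConstruction.Eⁿ 𝒟 k (EclConstruction.ι d))
mainTheorem1 𝒟 s h d 2≤s _ bd ‖d‖≡h (suc k) _ u r =
  ≤-trans (sizeBound-bounds _ (Eⁿ-LeavesBounded (suc k) bd) u r)
          (Eⁿ-sizeBound ‖d‖≡h k)
  where
  open Invariant 𝒟 s
  open Tower 𝒟 s 2≤s
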